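{- Let $\gamma,\gamma'$ be positive integers and $\varphi:\mathbf{CAs}^{(\gamma')}\to\mathbf{CAs}^{(\gamma)}$ an operad morphism. Then $\varphi$ is injective if and only if $\gamma=\gamma'$.
   Context: A binary tree is either the leaf or an ordered pair of binary trees. $\mathbf{Mag}$ is the nonsymmetric set-theoretic operad of binary trees ($\mathbf{Mag}(n)$ = trees with $n$ leaves), with $\mathfrak{t}\circ_i\mathfrak{s}$ grafting the root of $\mathfrak{s}$ onto the $i$-th leaf of $\mathfrak{t}$. Combs: $\mathrm{LComb}_1=\mathrm{RComb}_1=(\text{leaf},\text{leaf})$, $\mathrm{LComb}_d=(\mathrm{LComb}_{d-1},\text{leaf})$, $\mathrm{RComb}_d=(\text{leaf},\mathrm{RComb}_{d-1})$. For $\gamma\ge1$, $\equiv_\gamma$ is the smallest operad congruence on $\mathbf{Mag}$ with $\mathrm{LComb}_\gamma\equiv_\gamma\mathrm{RComb}_\gamma$, and $\mathbf{CAs}^{(\gamma)}:=\mathbf{Mag}/_{\equiv_\gamma}$. An operad morphism is an arity-preserving map sending unit to unit and commuting with partial compositions. -}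

module Defs where

open import Data.Nat using (ℕ; zero; suc; _+_; _∸_; _<_; _<?_)
open import Relation.Nullary using (yes; no)
open import Relation.Binary.PropositionalEquality using (_≡_)

data Tree : Set where
  leaf : Tree
  node : Tree → Tree → Tree

-- Number of leaves; Mag(n) = trees t with leaves t ≡ n.
leaves : Tree → ℕ
leaves leaf       = 1
leaves (node l r) = leaves l + leaves r

-- Partial composition t ∘_i s (leaves numbered from 0, i.e. i = paper's i - 1):
-- graft the root of s onto the i-th leaf of t.  Meaningful for i < leaves t.
graft : Tree → ℕ → Tree → Tree
graft leaf zero    s = s
graft leaf (suc i) s = leaf
graft (node l r) i s with i <? leaves l
... | yes _ = node (graft l i s) r
... | no  _ = node l (graft r (i ∸ leaves l) s)

-- Combs (LComb 0 = RComb 0 = leaf; for d ≥ 1 these agree with the paper).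
LComb : ℕ → Tree
LComb zero    = leaf
LComb (suc d) = node (LComb d) leaf

RComb : ℕ → Tree
RComb zero    = leaf
RComb (suc d) = node leaf (RComb d)

-- ≡_γ : the smallest operad congruence on Mag with LComb_γ ≡ RComb_γ
-- (equivalence relation compatible with all partial compositions).
data _≈[_]_ : Tree → ℕ → Tree → Set where
  gen    : ∀ {γ} → LComb γ ≈[ γ ] RComb γ
  ≈refl  : ∀ {γ t} → t ≈[ γ ] t
  ≈sym   : ∀ {γ t u} → t ≈[ γ ] u → u ≈[ γ ] t
  ≈trans : ∀ {γ t u v} → t ≈[ γ ] u → u ≈[ γ ] v → t ≈[ γ ] v
  ≈comp  : ∀ {γ t t' s s'} (i : ℕ) → i < leaves t →
           t ≈[ γ ] t' → s ≈[ γ ] s' → graft t i s ≈[ γ ] graft t' i s'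

-- An operad morphism CAs^(γ') → CAs^(γ), presented on representatives:
-- a map of trees that is well defined on ≡_γ'-classes, arity preserving,
-- sends the unit to the unit, and commutes with partial compositions
-- (modulo ≡_γ).
record IsOperadMorphism (γ' γ : ℕ) (φ : Tree → Tree) : Set where
  field
    well-defined : ∀ {t u} → t ≈[ γ' ] u → φ t ≈[ γ ] φ u
    arity        : ∀ t → leaves (φ t) ≡ leaves t
    unit         : φ leaf ≈[ γ ] leaf
    compose      : ∀ t i s → i < leaves t →
                   φ (graft t i s) ≈[ γ ] graft (φ t) i (φ s)

-- Injectivity of the induced map on the quotient CAs^(γ') → CAs^(γ).
InjectiveMod : (γ' γ : ℕ) → (Tree → Tree) → Set
InjectiveMod γ' γ φ = ∀ t u → φ t ≈[ γ ] φ u → t ≈[ γ' ] u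

-- An operad morphism φ preserves arities, so it fixes the only binary tree
-- node leaf leaf; since every tree is an iterated composition of that tree,
-- φ is the identity modulo ≡_γ. Well-definedness therefore gives ≡_γ' ⊆ ≡_γ,
-- and injectivity is equivalent to ≡_γ ⊆ ≡_γ'. The congruences are told apart
-- by their generators: ≡_n never relates two distinct trees with at most n
-- leaves, whereas LComb_d and RComb_d differ for d ≥ 2 and have d + 1 leaves.
module Submission where

open import Defs
open import Data.Nat using (ℕ; zero; suc; _+_; _∸_; _≤_; _<_; _<?_; _≤?_; z≤n; s≤s)
open import Data.Nat.Properties
open import Data.Product using (_×_; _,_)
open import Data.Empty using (⊥-elim)
open import Relation.Nullary using (yes; no)
open import Relation.Binary.Bundles using (Setoid)
open import Relation.Binary.PropositionalEquality
  using (_≡_; _≢_; refl; sym; trans; cong; cong₂; subst; module ≡-Reasoning)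

leaves-pos : ∀ t → 0 < leaves t
leaves-pos leaf       = s≤s z≤n
leaves-pos (node l r) = ≤-trans (leaves-pos l) (m≤m+n (leaves l) (leaves r))

leaves-graft : ∀ t i s → i < leaves t →
               suc (leaves (graft t i s)) ≡ leaves t + leaves s
leaves-graft leaf       zero    s _ = refl
leaves-graft leaf       (suc i) s (s≤s ())
leaves-graft (node l r) i       s i<t with i <? leaves l
... | yes i<l = begin
  suc (leaves (graft l i s)) + leaves r ≡⟨ cong (_+ leaves r) (leaves-graft l i s i<l) ⟩
  leaves l + leaves s + leaves r        ≡⟨ xy∙z≈xz∙y (leaves l) (leaves s) (leaves r) ⟩
  leaves l + leaves r + leaves s        ∎
  where
  open ≡-Reasoning
  open import Algebra.Properties.CommutativeSemigroup +-commutativeSemigroup using (xy∙z≈xz∙y)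
... | no  i≮l = begin
  suc (leaves l + leaves (graft r j s)) ≡⟨ sym (+-suc (leaves l) _) ⟩
  leaves l + suc (leaves (graft r j s)) ≡⟨ cong (leaves l +_) (leaves-graft r j s j<r) ⟩
  leaves l + (leaves r + leaves s)      ≡⟨ sym (+-assoc (leaves l) (leaves r) (leaves s)) ⟩
  leaves l + leaves r + leaves s        ∎
  where
  open ≡-Reasoning
  j = i ∸ leaves l
  j<r : j < leaves r
  j<r = subst (j <_) (m+n∸m≡n (leaves l) (leaves r)) (∸-monoˡ-< i<t (≮⇒≥ i≮l))

leaves-≤-graftˡ : ∀ t i s → i < leaves t → leaves t ≤ leaves (graft t i s)
leaves-≤-graftˡ t i s i<t =
  ≤-pred (subst (leaves t <_) (sym (leaves-graft t i s i<t)) (m<m+n (leaves t) (leaves-pos s)))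

leaves-≤-graftʳ : ∀ t i s → i < leaves t → leaves s ≤ leaves (graft t i s)
leaves-≤-graftʳ t i s i<t =
  ≤-pred (subst (leaves s <_) (sym (leaves-graft t i s i<t)) (m<n+m (leaves s) (leaves-pos t)))

leaves-LComb : ∀ d → leaves (LComb d) ≡ suc d
leaves-LComb zero    = refl
leaves-LComb (suc d) = trans (cong (_+ 1) (leaves-LComb d)) (+-comm (suc d) 1)

leaves-RComb : ∀ d → leaves (RComb d) ≡ suc d
leaves-RComb zero    = refl
leaves-RComb (suc d) = cong suc (leaves-RComb d)

LComb≢RComb : ∀ {d} → 2 ≤ d → LComb d ≢ RComb d
LComb≢RComb {1}           (s≤s ())
LComb≢RComb {suc (suc d)} _ ()

≈-setoid : ℕ → Setoid _ _
≈-setoid γ = record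
  { Carrier       = Tree
  ; _≈_           = _≈[ γ ]_
  ; isEquivalence = record { refl = ≈refl ; sym = ≈sym ; trans = ≈trans }
  }

≈⇒leaves≡ : ∀ {γ t u} → t ≈[ γ ] u → leaves t ≡ leaves u
≈⇒leaves≡ {γ} gen = trans (leaves-LComb γ) (sym (leaves-RComb γ))
≈⇒leaves≡ ≈refl        = refl
≈⇒leaves≡ (≈sym p)     = sym (≈⇒leaves≡ p)
≈⇒leaves≡ (≈trans p q) = trans (≈⇒leaves≡ p) (≈⇒leaves≡ q)
≈⇒leaves≡ (≈comp {t = t} {t'} {s} {s'} i i<t p q) = suc-injective (begin
  suc (leaves (graft t i s))   ≡⟨ leaves-graft t i s i<t ⟩
  leaves t + leaves s          ≡⟨ cong₂ _+_ (≈⇒leaves≡ p) (≈⇒leaves≡ q) ⟩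
  leaves t' + leaves s'        ≡⟨ sym (leaves-graft t' i s' (subst (i <_) (≈⇒leaves≡ p) i<t)) ⟩
  suc (leaves (graft t' i s')) ∎)
  where open ≡-Reasoning

≈[1]⇒≡ : ∀ {t u} → t ≈[ 1 ] u → t ≡ u
≈[1]⇒≡ gen            = refl
≈[1]⇒≡ ≈refl          = refl
≈[1]⇒≡ (≈sym p)       = sym (≈[1]⇒≡ p)
≈[1]⇒≡ (≈trans p q)   = trans (≈[1]⇒≡ p) (≈[1]⇒≡ q)
≈[1]⇒≡ (≈comp i _ p q) = cong₂ (λ t s → graft t i s) (≈[1]⇒≡ p) (≈[1]⇒≡ q)

-- Every step of a derivation stays among trees of the same arity, and the
-- generator needs arity n + 1.
≈⇒≡-if-leaves≤ : ∀ {n t u} → leaves t ≤ n → t ≈[ n ] u → t ≡ u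
≈⇒≡-if-leaves≤ {n} t≤n gen = ⊥-elim (<-irrefl refl (subst (_≤ n) (leaves-LComb n) t≤n))
≈⇒≡-if-leaves≤ t≤n ≈refl   = refl
≈⇒≡-if-leaves≤ t≤n (≈sym p) =
  sym (≈⇒≡-if-leaves≤ (subst (_≤ _) (sym (≈⇒leaves≡ p)) t≤n) p)
≈⇒≡-if-leaves≤ t≤n (≈trans p q) with ≈⇒≡-if-leaves≤ t≤n p
... | refl = ≈⇒≡-if-leaves≤ t≤n q
≈⇒≡-if-leaves≤ t≤n (≈comp {t = t} {s = s} i i<t p q) = cong₂ (λ t s → graft t i s)
  (≈⇒≡-if-leaves≤ (≤-trans (leaves-≤-graftˡ t i s i<t) t≤n) p)
  (≈⇒≡-if-leaves≤ (≤-trans (leaves-≤-graftʳ t i s i<t) t≤n) q)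

combs-≈⇒≤ : ∀ {d n} → 2 ≤ d → LComb d ≈[ n ] RComb d → n ≤ d
combs-≈⇒≤ {d} {n} 2≤d p with n ≤? d
... | yes n≤d = n≤d
... | no  n≰d = ⊥-elim (LComb≢RComb 2≤d
  (≈⇒≡-if-leaves≤ (subst (_≤ n) (sym (leaves-LComb d)) (≰⇒> n≰d)) p))

combs-≈-mutual⇒≡ : ∀ {γ γ'} → 1 ≤ γ → 1 ≤ γ' →
                   LComb γ ≈[ γ' ] RComb γ → LComb γ' ≈[ γ ] RComb γ' → γ ≡ γ'
combs-≈-mutual⇒≡ {1}           {1}           _ _ _ _ = refl
combs-≈-mutual⇒≡ {1}           {suc (suc _)} _ _ _ q =
  ⊥-elim (LComb≢RComb (s≤s (s≤s z≤n)) (≈[1]⇒≡ q))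
combs-≈-mutual⇒≡ {suc (suc _)} {1}           _ _ p _ =
  ⊥-elim (LComb≢RComb (s≤s (s≤s z≤n)) (≈[1]⇒≡ p))
combs-≈-mutual⇒≡ {suc (suc _)} {suc (suc _)} _ _ p q =
  ≤-antisym (combs-≈⇒≤ (s≤s (s≤s z≤n)) q) (combs-≈⇒≤ (s≤s (s≤s z≤n)) p)

one-leaf⇒≡leaf : ∀ t → leaves t ≡ 1 → t ≡ leaf
one-leaf⇒≡leaf leaf       _ = refl
one-leaf⇒≡leaf (node l r) e =
  ⊥-elim (<-irrefl (sym e) (+-mono-≤ (leaves-pos l) (leaves-pos r)))

two-leaves⇒≡node : ∀ t → leaves t ≡ 2 → t ≡ node leaf leaf
two-leaves⇒≡node (node leaf r)       e = cong (node leaf) (one-leaf⇒≡leaf r (suc-injective e))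
two-leaves⇒≡node (node (node a b) r) e = ⊥-elim (<-irrefl (sym e)
  (+-mono-≤ (+-mono-≤ (leaves-pos a) (leaves-pos b)) (leaves-pos r)))

module _ {γ' γ : ℕ} {φ : Tree → Tree} (M : IsOperadMorphism γ' γ φ) where
  open IsOperadMorphism M

  morphism-≈-id : ∀ t → φ t ≈[ γ ] t
  morphism-≈-id leaf       = unit
  -- node l r is definitionally graft (graft N 1 r) 0 l.
  morphism-≈-id (node l r) = begin
    φ (graft (graft N 1 r) 0 l)
      ≈⟨ compose (node leaf r) 0 l (s≤s z≤n) ⟩
    graft (φ (node leaf r)) 0 (φ l)
      ≈⟨ ≈comp 0 (leaves-pos (φ (node leaf r))) (compose N 1 r (s≤s (s≤s z≤n))) ≈refl ⟩
    graft (graft (φ N) 1 (φ r)) 0 (φ l)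
      ≈⟨ ≈comp 0 (leaves-pos (graft (φ N) 1 (φ r)))
           (≈comp 1 1<φN (reflexive φN≡N) (morphism-≈-id r)) (morphism-≈-id l) ⟩
    graft (graft N 1 r) 0 l
      ∎
    where
    open Setoid (≈-setoid γ) using (reflexive)
    open import Relation.Binary.Reasoning.Setoid (≈-setoid γ)
    N = node leaf leaf
    φN≡N : φ N ≡ N
    φN≡N = two-leaves⇒≡node (φ N) (arity N)
    1<φN : 1 < leaves (φ N)
    1<φN = subst (1 <_) (sym (arity N)) (s≤s (s≤s z≤n))

  morphism⇒≈-⊆ : ∀ {t u} → t ≈[ γ' ] u → t ≈[ γ ] u
  morphism⇒≈-⊆ {t} {u} p =
    ≈trans (≈sym (morphism-≈-id t)) (≈trans (well-defined p) (morphism-≈-id u))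

  injective⇒≈-⊇ : InjectiveMod γ' γ φ → ∀ {t u} → t ≈[ γ ] u → t ≈[ γ' ] u
  injective⇒≈-⊇ inj {t} {u} p =
    inj t u (≈trans (morphism-≈-id t) (≈trans p (≈sym (morphism-≈-id u))))

  ≈-⊇⇒injective : (∀ {t u} → t ≈[ γ ] u → t ≈[ γ' ] u) → InjectiveMod γ' γ φ
  ≈-⊇⇒injective ⊇ t u p =
    ⊇ (≈trans (≈sym (morphism-≈-id t)) (≈trans p (morphism-≈-id u)))

lemma3p2p3 : (γ γ' : ℕ) → 1 ≤ γ → 1 ≤ γ' → (φ : Tree → Tree) →
             IsOperadMorphism γ' γ φ →
             (InjectiveMod γ' γ φ → γ ≡ γ') × (γ ≡ γ' → InjectiveMod γ' γ φ)
lemma3p2p3 γ γ' 1≤γ 1≤γ' φ M = injective⇒≡ , ≡⇒injective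
  where
  injective⇒≡ : InjectiveMod γ' γ φ → γ ≡ γ'
  injective⇒≡ inj =
    combs-≈-mutual⇒≡ 1≤γ 1≤γ' (injective⇒≈-⊇ M inj gen) (morphism⇒≈-⊆ M gen)
  ≡⇒injective : γ ≡ γ' → InjectiveMod γ' γ φ
  ≡⇒injective refl = ≈-⊇⇒injective M (λ p → p)
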